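{- Let $\mathcal{D}$ be a non-principal ultrafilter on $I=\bigcup_{i<\omega}\{i\}\times(i+1)$. (1) If $\mathcal{D}$ is interesting then it is not a $q$-point. (2) If $\mathcal{D}$ is Ramsey then $\mathcal{D}$ is almost Ramsey. (3) If $\mathcal{D}$ is semi-Ramsey then it is a $p$-point. (4) If $\mathcal{D}$ is semi-Ramsey then $\mathcal{D}^*=\{A\subseteq\omega:\bigcup_{i\in A}\{i\}\times(i+1)\in\mathcal{D}\}$ is a Ramsey ultrafilter on $\omega$.
   Context: For a filter $\mathcal{D}$ on a countable set $Z$: $\mathcal{D}$ is Ramsey if every colouring $F:[Z]^2\to 2$ has a homogeneous set in $\mathcal{D}$; $\mathcal{D}$ is a $p$-point if for every partition $\langle A_n:n<\omega\rangle$ of $Z$ into sets with $Z\setminus A_n\in\mathcal{D}$ there is $A\in\mathcal{D}$ with $A\cap A_n$ finite for all $n$; $\mathcal{D}$ is a $q$-point if for every partition $\langle A_n\rangle$ of $Z$ into finite sets there is $A\in\mathcal{D}$ with $|A\cap A_n|\le1$ for all $n$. For a filter $\mathcal{D}$ on $I=\bigcup_{i<\omega}\{i\}\times(i+1)$: $\mathcal{D}$ is interesting if for no $h\in\prod_{i}(i+1)$ is $\{(i,h(i)):i\in\omega\}\in\mathcal{D}$. The game $G^{sR}(\mathcal{D})$: at move $n$, Player I plays $A_n\in\mathcal{D}$ and Player II answers with $i_n\in\omega$ and $a_n\in[A_n\cap(\{i_n\}\times(i_n+1))]^{\le n}$; Player I wins if $\bigcup_n a_n\notin\mathcal{D}$.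 $\mathcal{D}$ is semi-Ramsey if Player I has no winning strategy in $G^{sR}(\mathcal{D})$. $\mathcal{D}$ is almost Ramsey if it is semi-Ramsey and for every $n,L<\omega$ and every colouring $f:\bigcup_i[\{i\}\times(i+1)]^{\le n}\to L$ there is $A\in\mathcal{D}$ such that for every $i$ and every $k\le n$, $f\restriction[A\cap(\{i\}\times(i+1))]^k$ is constant. -}

module Defs where

open import Level using (0ℓ)
open import Data.Nat using (ℕ; suc; _≤_)
open import Data.Fin using (Fin)
open import Data.Bool using (Bool)
open import Data.Product using (Σ; ∃; _×_; _,_; proj₁; proj₂)
open import Data.Sum using (_⊎_)
open import Data.Unit using (⊤)
open import Data.Empty using (⊥)
open import Data.List using (List; length; map; upTo)
open import Data.List.Membership.Propositional using (_∈_)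
open import Data.Fin.Subset as FS using (Subset; ∣_∣)
open import Relation.Nullary using (¬_)
open import Relation.Binary.PropositionalEquality using (_≡_; _≢_)

PSet : Set → Set₁
PSet Z = Z → Set

Family : Set → Set₁
Family Z = PSet Z → Set

_⊆'_ : {Z : Set} → PSet Z → PSet Z → Set
A ⊆' B = ∀ z → A z → B z

Finite : {Z : Set} → PSet Z → Set
Finite {Z} A = Σ (List Z) λ l → ∀ z → A z → z ∈ l

record IsFilter {Z : Set} (D : Family Z) : Set₁ where
  field
    full     : D (λ _ → ⊤)
    proper   : ¬ D (λ _ → ⊥)
    upward   : ∀ (A B : PSet Z) → A ⊆' B → D A → D B
    inter    : ∀ (A B : PSet Z) → D A → D B → D (λ z → A z × B z)

record IsUltrafilter {Z : Set} (D : Family Z) : Set₁ where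
  field
    isFilter : IsFilter D
    ultra    : ∀ (A : PSet Z) → D A ⊎ D (λ z → ¬ A z)

NonPrincipal : {Z : Set} → Family Z → Set
NonPrincipal {Z} D = ∀ (z : Z) → ¬ D (λ x → x ≡ z)

-- colourings F : [Z]^2 → 2, given as symmetric functions on pairs
Ramsey : {Z : Set} → Family Z → Set₁
Ramsey {Z} D =
  ∀ (F : Z → Z → Bool) → (∀ x y → F x y ≡ F y x) →
  Σ (PSet Z) λ H → D H × Σ Bool λ c →
    ∀ x y → H x → H y → x ≢ y → F x y ≡ c

-- P : ℕ → PSet Z is a partition of Z (pieces may be empty)
IsPartition : {Z : Set} → (ℕ → PSet Z) → Set
IsPartition {Z} P =
  (∀ (z : Z) → Σ ℕ λ n → P n z) ×
  (∀ (z : Z) n m → P n z → P m z → n ≡ m)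

PPoint : {Z : Set} → Family Z → Set₁
PPoint {Z} D =
  ∀ (P : ℕ → PSet Z) → IsPartition P → (∀ n → D (λ z → ¬ P n z)) →
  Σ (PSet Z) λ A → D A × (∀ n → Finite (λ z → A z × P n z))

QPoint : {Z : Set} → Family Z → Set₁
QPoint {Z} D =
  ∀ (P : ℕ → PSet Z) → IsPartition P → (∀ n → Finite (P n)) →
  Σ (PSet Z) λ A → D A ×
    (∀ n x y → A x → P n x → A y → P n y → x ≡ y)

I : Set
I = Σ ℕ λ i → Fin (suc i)

Block : ℕ → PSet I
Block i x = proj₁ x ≡ i

Interesting : Family I → Set
Interesting D = ∀ (h : (i : ℕ) → Fin (suc i)) → ¬ D (λ x → x ≡ (proj₁ x , h (proj₁ x)))

-- A move of Player II: a number i_n and a finite set a_n, given by a list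
-- of elements of I (duplicates allowed; the set is its range).
Move : Set
Move = ℕ × List I

-- strategy of Player I: from the history of II's moves to a set
-- (Player I's own earlier moves are determined by the strategy).
StrategyI : Family I → Set₁
StrategyI D = Σ (List Move → PSet I) λ σ → ∀ h → D (σ h)

history : (ℕ → Move) → ℕ → List Move
history m n = map m (upTo n)

LegalAgainst : (List Move → PSet I) → (ℕ → Move) → Set
LegalAgainst σ m =
  ∀ n → length (proj₂ (m n)) ≤ n ×
        (∀ x → x ∈ proj₂ (m n) → σ (history m n) x × Block (proj₁ (m n)) x)

UnionOfPlay : (ℕ → Move) → PSet I
UnionOfPlay m x = Σ ℕ λ n → x ∈ proj₂ (m n)

WinningI : (D : Family I) → StrategyI D → Set
WinningI D σ = ∀ (m : ℕ → Move) → LegalAgainst (proj₁ σ) m → ¬ D (UnionOfPlay m)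

SemiRamsey : Family I → Set₁
SemiRamsey D = ¬ (Σ (StrategyI D) λ σ → WinningI D σ)

-- subsets of the block {i} × (i+1) are Subset (suc i); a colouring of
-- ⋃_i [{i}×(i+1)]^{≤n} into L colours is given (extended arbitrarily) on all
-- subsets of each block; only its values on sets of size ≤ n matter.
AlmostRamsey : Family I → Set₁
AlmostRamsey D =
  SemiRamsey D ×
  (∀ (n L : ℕ) (f : (i : ℕ) → Subset (suc i) → Fin L) →
    Σ (PSet I) λ A → D A ×
      (∀ i k → k ≤ n → ∀ (s t : Subset (suc i)) →
         ∣ s ∣ ≡ k → ∣ t ∣ ≡ k →
         (∀ j → j FS.∈ s → A (i , j)) →
         (∀ j → j FS.∈ t → A (i , j)) →
         f i s ≡ f i t))

Star : Family I → Family ℕ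
Star D A = D (λ x → A (proj₁ x))

-- (1) A q-point selector for the partition into blocks meets each block at most once, so it lies
-- inside the graph of some h ∈ ∏ (i + 1).  (3), (4) Player I answers every move by a set in D that
-- forbids what the earlier moves make undesirable (the pieces already hit; points whose index has the
-- wrong colour with an earlier index); if the union of such a play were in D it would be the required
-- p-point witness or homogeneous set, so semi-Ramseyness yields it.  (2) Given a strategy σ of I, colour
-- a pair x, y in blocks i < j by whether y is a legal answer to every short history of moves in blocks
-- ≤ i.  A homogeneous set of the other colour would lie in finitely many blocks; on a homogeneous set of
-- this colour that meets blocks at most once, II can play its points block by block, legally against σ,
-- and the union of the play contains it, so σ is not winning.

module Submission where

open import Defs
open import Level using (0ℓ; lift; lower)
open import Axiom.ExcludedMiddle using (ExcludedMiddle)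
open import Axiom.DoubleNegationElimination using (em⇒dne)
open import Function using (_∘_; case_of_)
open import Function.Bundles using (mk⇔)
open import Data.Bool using (Bool; true; false)
open import Data.Bool.Properties using (¬-not)
open import Data.Empty using (⊥-elim)
open import Data.Nat using (ℕ; zero; suc; _+_; _≤_; _<_; z≤n; s≤s; _≟_; _≤?_)
open import Data.Nat.Properties
open import Data.Nat.Induction using (<-rec)
open import Data.Fin using (Fin) renaming (zero to fzero)
open import Data.Fin.Subset as FS using (Subset; ∣_∣; ⁅_⁆)
open import Data.Fin.Subset.Properties
  using (nonempty?; Empty-unique; ⊆-antisym; x∈⁅x⁆; x∈⁅y⁆⇒x≡y; ∣⊥∣≡0; ∣⁅x⁆∣≡1)
open import Data.Product using (Σ; _×_; _,_; proj₁; proj₂; swap)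
open import Data.Sum using (_⊎_; inj₁; inj₂)
open import Data.List using (List; []; _∷_; map; upTo; allFin; concatMap; cartesianProductWith; length)
open import Data.List.Relation.Unary.Any using (here; there)
open import Data.List.Membership.Propositional using (_∈_; lose)
open import Data.List.Membership.Propositional.Properties
  using (∈-map⁺; ∈-map⁻; ∈-allFin; ∈-upTo⁺; ∈-upTo⁻; ∈-concatMap⁺; ∈-cartesianProductWith⁺)
open import Data.List.Properties using (length-map; length-upTo)
open import Relation.Nullary using (¬_; Dec; yes; no; contradiction)
open import Relation.Nullary.Decidable using (does; map′; dec-true; does-⇔)
open import Relation.Binary.Definitions using (tri<; tri≈; tri>)
open import Relation.Binary.PropositionalEquality using (_≡_; _≢_; refl; sym; trans; cong; subst)

lower-em : ExcludedMiddle (Level.suc 0ℓ) → ExcludedMiddle 0ℓ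
lower-em em = map′ lower lift em

does⇒ : {P : Set} (d : Dec P) → does d ≡ true → P
does⇒ (yes p) _ = p

InjectiveOn : {Z W : Set} → (Z → W) → PSet Z → Set
InjectiveOn g S = ∀ x y → S x → S y → g x ≡ g y → x ≡ y

StrictlyIncreasing : (ℕ → ℕ) → Set
StrictlyIncreasing f = ∀ k → f k < f (suc k)

module _ {f : ℕ → ℕ} (increasing : StrictlyIncreasing f) where

  increasing⇒monotone : ∀ {j k} → j ≤ k → f j ≤ f k
  increasing⇒monotone {k = zero} z≤n = ≤-refl
  increasing⇒monotone {k = suc k} j≤1+k with m≤n⇒m<n∨m≡n j≤1+k
  ... | inj₁ j<1+k = ≤-trans (increasing⇒monotone (≤-pred j<1+k)) (<⇒≤ (increasing k))
  ... | inj₂ refl  = ≤-refl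

  increasing⇒≥id : ∀ k → k ≤ f k
  increasing⇒≥id zero    = z≤n
  increasing⇒≥id (suc k) = ≤-trans (s≤s (increasing⇒≥id k)) (increasing k)

record Enumeration (E : ℕ → Set) : Set where
  field
    at         : ℕ → ℕ
    increasing : StrictlyIncreasing at
    member     : ∀ k → E (at k)
    onto       : ∀ i → E i → Σ ℕ λ k → at k ≡ i

module _ (em : ExcludedMiddle 0ℓ) {E : ℕ → Set} where

  LeastFrom : ℕ → ℕ → Set
  LeastFrom a i = a ≤ i × E i × (∀ j → a ≤ j → j < i → ¬ E j)

  least-from : ∀ {a} i → a ≤ i → E i → Σ ℕ (LeastFrom a)
  least-from {a} = <-rec (λ i → a ≤ i → E i → Σ ℕ (LeastFrom a)) step
    where
      step : ∀ i → (∀ {j} → j < i → a ≤ j → E j → Σ ℕ (LeastFrom a)) →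
             a ≤ i → E i → Σ ℕ (LeastFrom a)
      step i smaller a≤i Ei with em {Σ ℕ λ j → a ≤ j × j < i × E j}
      ... | yes (j , a≤j , j<i , Ej) = smaller j<i a≤j Ej
      ... | no none = i , a≤i , Ei , λ j a≤j j<i Ej → none (j , a≤j , j<i , Ej)

  enumerate : (∀ a → Σ ℕ λ i → a ≤ i × E i) → Enumeration E
  enumerate unbounded = record { at = at ; increasing = increasing ; member = member ; onto = onto }
    where
      next : ∀ a → Σ ℕ (LeastFrom a)
      next a = least-from (proj₁ (unbounded a)) (proj₁ (proj₂ (unbounded a))) (proj₂ (proj₂ (unbounded a)))

      start : ℕ → ℕ
      at : ℕ → ℕ
      at k = proj₁ (next (start k))
      start zero    = 0
      start (suc k) = suc (at k)

      least : ∀ k → LeastFrom (start k) (at k)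
      least k = proj₂ (next (start k))

      increasing : StrictlyIncreasing at
      increasing k = proj₁ (least (suc k))

      member : ∀ k → E (at k)
      member k = proj₁ (proj₂ (least k))

      at-minimal : ∀ k {i} → start k ≤ i → E i → at k ≤ i
      at-minimal k {i} start≤i Ei with at k ≤? i
      ... | yes at≤i = at≤i
      ... | no at≰i  = contradiction Ei (proj₂ (proj₂ (least k)) i start≤i (≰⇒> at≰i))

      hit-or-below : ∀ {i} → E i → ∀ k → (Σ ℕ λ k′ → at k′ ≡ i) ⊎ at k ≤ i
      hit-or-below Ei zero = inj₂ (at-minimal zero z≤n Ei)
      hit-or-below {i} Ei (suc k) with hit-or-below Ei k
      ... | inj₁ hit = inj₁ hit
      ... | inj₂ at≤i with at k ≟ i
      ...   | yes hit  = inj₁ (k , hit)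
      ...   | no  at≢i = inj₂ (at-minimal (suc k) (≤∧≢⇒< at≤i at≢i) Ei)

      onto : ∀ i → E i → Σ ℕ λ k → at k ≡ i
      onto i Ei with hit-or-below Ei (suc i)
      ... | inj₁ hit     = hit
      ... | inj₂ at≤i    = contradiction (≤-trans (increasing⇒≥id increasing (suc i)) at≤i) 1+n≰n

lists≤ : {A : Set} → List A → ℕ → List (List A)
lists≤ xs zero    = [] ∷ []
lists≤ xs (suc n) = [] ∷ cartesianProductWith _∷_ xs (lists≤ xs n)

∈-lists≤ : {A : Set} (xs : List A) {n : ℕ} (ys : List A) →
           length ys ≤ n → (∀ y → y ∈ ys → y ∈ xs) → ys ∈ lists≤ xs n
∈-lists≤ xs {zero}  []       _          _  = here refl
∈-lists≤ xs {suc n} []       _          _  = here refl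
∈-lists≤ xs {suc n} (y ∷ ys) (s≤s len) ⊆xs =
  there (∈-cartesianProductWith⁺ _∷_ (⊆xs y (here refl)) (∈-lists≤ xs ys len (λ z z∈ys → ⊆xs z (there z∈ys))))

⊥-or-singleton : ∀ {n} (s : Subset n) → (∀ j j′ → j FS.∈ s → j′ FS.∈ s → j ≡ j′) →
                 s ≡ FS.⊥ ⊎ Σ (Fin n) λ j → s ≡ ⁅ j ⁆
⊥-or-singleton s subsingleton with nonempty? s
... | no empty = inj₁ (Empty-unique empty)
... | yes (j , j∈s) = inj₂ (j , ⊆-antisym s⊆⁅j⁆ ⁅j⁆⊆s)
  where
    s⊆⁅j⁆ : s FS.⊆ ⁅ j ⁆
    s⊆⁅j⁆ j′∈s = subst (FS._∈ ⁅ j ⁆) (subsingleton j _ j∈s j′∈s) (x∈⁅x⁆ j)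
    ⁅j⁆⊆s : ⁅ j ⁆ FS.⊆ s
    ⁅j⁆⊆s j′∈⁅j⁆ = subst (FS._∈ s) (sym (x∈⁅y⁆⇒x≡y j j′∈⁅j⁆)) j∈s

subsets-of-subsingleton : ∀ {n} (Q : Fin n → Set) → (∀ j j′ → Q j → Q j′ → j ≡ j′) →
                          (s t : Subset n) → (∀ j → j FS.∈ s → Q j) → (∀ j → j FS.∈ t → Q j) →
                          ∣ s ∣ ≡ ∣ t ∣ → s ≡ t
subsets-of-subsingleton {n} Q subsingleton s t s⊆Q t⊆Q |s|≡|t|
  with ⊥-or-singleton s (λ j j′ j∈ j′∈ → subsingleton j j′ (s⊆Q j j∈) (s⊆Q j′ j′∈))
     | ⊥-or-singleton t (λ j j′ j∈ j′∈ → subsingleton j j′ (t⊆Q j j∈) (t⊆Q j′ j′∈))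
... | inj₁ refl       | inj₁ refl       = refl
... | inj₁ refl       | inj₂ (j′ , refl) = contradiction (trans (sym (∣⊥∣≡0 n)) (trans |s|≡|t| (∣⁅x⁆∣≡1 j′))) λ ()
... | inj₂ (j , refl) | inj₁ refl       = contradiction (trans (sym (∣⁅x⁆∣≡1 j)) (trans |s|≡|t| (∣⊥∣≡0 n))) λ ()
... | inj₂ (j , refl) | inj₂ (j′ , refl) =
  cong ⁅_⁆ (subsingleton j j′ (s⊆Q j (x∈⁅x⁆ j)) (t⊆Q j′ (x∈⁅x⁆ j′)))

module FilterProperties {Z : Set} {D : Family Z} (filter : IsFilter D) where
  open IsFilter filter

  ⋂-∈ : {J : Set} (B : J → PSet Z) → (∀ j → D (B j)) → (js : List J) →
        D (λ z → ∀ j → j ∈ js → B j z)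
  ⋂-∈ B B∈D []       = upward _ _ (λ _ _ _ ()) full
  ⋂-∈ B B∈D (j ∷ js) = upward _ _ cons (inter _ _ (B∈D j) (⋂-∈ B B∈D js))
    where
      cons : ∀ z → B j z × (∀ j′ → j′ ∈ js → B j′ z) → ∀ j′ → j′ ∈ j ∷ js → B j′ z
      cons z (b , _)  _  (here refl)  = b
      cons z (_ , bs) j′ (there j′∈) = bs j′ j′∈

  ∈⇒nonempty : ExcludedMiddle 0ℓ → ∀ {A} → D A → Σ Z A
  ∈⇒nonempty em {A} A∈D with em {Σ Z A}
  ... | yes witness = witness
  ... | no empty    = ⊥-elim (proper (upward A _ (λ z a → empty (z , a)) A∈D))

  ramsey⇒injectiveOn : ExcludedMiddle 0ℓ → Ramsey D → (g : Z → ℕ) → (∀ n → ¬ D (λ z → g z ≡ n)) →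
                       Σ (PSet Z) λ S → D S × InjectiveOn g S
  ramsey⇒injectiveOn em ram g fibre∉ with ram (λ x y → does (g x ≟ g y))
                                              (λ x y → does-⇔ (mk⇔ sym sym) (g x ≟ g y) (g y ≟ g x))
  ... | H , H∈D , false , hom = H , H∈D , injective
    where
      injective : InjectiveOn g H
      injective x y x∈H y∈H gx≡gy with em {x ≡ y}
      ... | yes x≡y = x≡y
      ... | no x≢y  = case trans (sym (dec-true (g x ≟ g y) gx≡gy)) (hom x y x∈H y∈H x≢y) of λ ()
  ... | H , H∈D , true , hom = ⊥-elim (fibre∉ (g x) (upward H _ H⊆fibre H∈D))
    where
      x = proj₁ (∈⇒nonempty em H∈D)
      x∈H = proj₂ (∈⇒nonempty em H∈D)
      H⊆fibre : ∀ y → H y → g y ≡ g x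
      H⊆fibre y y∈H with em {y ≡ x}
      ... | yes refl = refl
      ... | no y≢x   = does⇒ (g y ≟ g x) (hom y x y∈H x∈H y≢x)

module UltrafilterProperties {Z : Set} {D : Family Z} (uf : IsUltrafilter D) where
  open IsUltrafilter uf
  open IsFilter isFilter
  open FilterProperties isFilter public

  finite∉ : NonPrincipal D → (zs : List Z) (A : PSet Z) → (∀ z → A z → z ∈ zs) → ¬ D A
  finite∉ np [] A A⊆[] A∈D = proper (upward A _ (λ z a → case A⊆[] z a of λ ()) A∈D)
  finite∉ np (z ∷ zs) A A⊆z∷zs A∈D with ultra (_≡ z)
  ... | inj₁ ｛z｝∈D = np z ｛z｝∈D
  ... | inj₂ ≢z∈D = finite∉ np zs (λ y → A y × y ≢ z) A∖z⊆zs (inter _ _ A∈D ≢z∈D)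
    where
      A∖z⊆zs : ∀ y → A y × y ≢ z → y ∈ zs
      A∖z⊆zs y (a , y≢z) with A⊆z∷zs y a
      ... | here y≡z  = contradiction y≡z y≢z
      ... | there y∈  = y∈

  bool-colour : (g : Z → Bool) → Σ Bool λ b → D (λ z → g z ≡ b)
  bool-colour g with ultra (λ z → g z ≡ true)
  ... | inj₁ true∈D  = true , true∈D
  ... | inj₂ ≢true∈D = false , upward _ _ (λ _ → ¬-not) ≢true∈D

Pushforward : {Z W : Set} → (Z → W) → Family Z → Family W
Pushforward f D A = D (λ z → A (f z))

Pushforward-isUltrafilter : {Z W : Set} {D : Family Z} (f : Z → W) → IsUltrafilter D →
                            IsUltrafilter (Pushforward f D)
Pushforward-isUltrafilter f uf = record
  { isFilter = record
    { full   = full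
    ; proper = proper
    ; upward = λ A B A⊆B → upward _ _ (λ z → A⊆B (f z))
    ; inter  = λ A B → inter _ _
    }
  ; ultra = λ A → ultra (λ z → A (f z))
  }
  where
    open IsUltrafilter uf
    open IsFilter isFilter

blockPoints : ℕ → List I
blockPoints i = map (i ,_) (allFin (suc i))

∈-blockPoints : (x : I) → x ∈ blockPoints (proj₁ x)
∈-blockPoints (i , j) = ∈-map⁺ (i ,_) (∈-allFin j)

pointsUpTo : ℕ → List I
pointsUpTo K = concatMap blockPoints (upTo (suc K))

∈-pointsUpTo : ∀ {K} (x : I) → proj₁ x ≤ K → x ∈ pointsUpTo K
∈-pointsUpTo x x≤K = ∈-concatMap⁺ blockPoints (lose (∈-upTo⁺ (s≤s x≤K)) (∈-blockPoints x))

Blocks-isPartition : IsPartition Block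
Blocks-isPartition = (λ x → proj₁ x , refl) , (λ x n m x∈n x∈m → trans (sym x∈n) x∈m)

Block-finite : ∀ n → Finite (Block n)
Block-finite n = blockPoints n , λ { x refl → ∈-blockPoints x }

module _ {D : Family I} (uf : IsUltrafilter D) (np : NonPrincipal D) where
  open UltrafilterProperties uf

  bounded∉ : (K : ℕ) (A : PSet I) → (∀ x → A x → proj₁ x ≤ K) → ¬ D A
  bounded∉ K A bounded = finite∉ np (pointsUpTo K) A (λ x a → ∈-pointsUpTo x (bounded x a))

  Block∉ : ∀ i → ¬ D (Block i)
  Block∉ i = bounded∉ i (Block i) (λ x x∈i → ≤-reflexive x∈i)

  ∈⇒unbounded : ExcludedMiddle 0ℓ → ∀ {A} → D A →
                ∀ a → Σ ℕ λ i → a ≤ i × Σ (Fin (suc i)) λ j → A (i , j)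
  ∈⇒unbounded em {A} A∈D a with em {Σ ℕ λ i → a ≤ i × Σ (Fin (suc i)) λ j → A (i , j)}
  ... | yes witness = witness
  ... | no none     = ⊥-elim (bounded∉ a A bounded A∈D)
    where
      bounded : ∀ x → A x → proj₁ x ≤ a
      bounded (i , j) x∈A with a ≤? i
      ... | yes a≤i = contradiction (i , a≤i , j , x∈A) none
      ... | no a≰i  = <⇒≤ (≰⇒> a≰i)

graph-through : ExcludedMiddle 0ℓ → (A : PSet I) → InjectiveOn proj₁ A →
                Σ ((i : ℕ) → Fin (suc i)) λ h → ∀ x → A x → x ≡ (proj₁ x , h (proj₁ x))
graph-through em A injective = h , A⊆graph
  where
    Meets : ℕ → Set
    Meets i = Σ (Fin (suc i)) λ j → A (i , j)
    pick : ∀ i → Dec (Meets i) → Fin (suc i)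
    pick i (yes (j , _)) = j
    pick i (no _)        = fzero
    h : (i : ℕ) → Fin (suc i)
    h i = pick i em
    picked : ∀ i j → A (i , j) → (d : Dec (Meets i)) → (i , j) ≡ (i , pick i d)
    picked i j a (yes (j′ , a′)) = injective (i , j) (i , j′) a a′ refl
    picked i j a (no none)       = contradiction (j , a) none
    A⊆graph : ∀ x → A x → x ≡ (proj₁ x , h (proj₁ x))
    A⊆graph (i , j) a = picked i j a em

interesting⇒¬qPoint : ExcludedMiddle 0ℓ → {D : Family I} → IsFilter D → Interesting D → ¬ QPoint D
interesting⇒¬qPoint em filter interesting qPoint
  with qPoint Block Blocks-isPartition Block-finite
... | A , A∈D , once with graph-through em A (λ x y x∈A y∈A x~y → once (proj₁ y) x y x∈A x~y y∈A refl)
...   | h , A⊆graph = interesting h (IsFilter.upward filter A _ A⊆graph A∈D)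

∈-history : (m : ℕ → Move) → ∀ {j k} → j < k → m j ∈ history m k
∈-history m j<k = ∈-map⁺ m (∈-upTo⁺ j<k)

Reacting : (Move → PSet I) → List Move → PSet I
Reacting B h x = ∀ e → e ∈ h → B e x

reacting-strategy : {D : Family I} → IsFilter D → (B : Move → PSet I) → (∀ e → D (B e)) → StrategyI D
reacting-strategy filter B B∈D = Reacting B , FilterProperties.⋂-∈ filter B B∈D

later-reacts : ∀ {B m} → LegalAgainst (Reacting B) m → ∀ {j k x} → j < k → x ∈ proj₂ (m k) → B (m j) x
later-reacts {m = m} legal {k = k} j<k x∈ = proj₁ (proj₂ (legal k) _ x∈) _ (∈-history m j<k)

semiRamsey⇒pPoint : ExcludedMiddle (Level.suc 0ℓ) → {D : Family I} → IsFilter D → SemiRamsey D → PPoint D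
semiRamsey⇒pPoint em {D} filter semiRamsey P (covers , disjoint) ∁P∈D =
  em⇒dne em λ ¬pPoint → semiRamsey (strategy , winning ¬pPoint)
  where
    piece : I → ℕ
    piece z = proj₁ (covers z)
    piece-unique : ∀ {n p} → P n p → piece p ≡ n
    piece-unique {p = p} p∈n = disjoint p _ _ (proj₂ (covers p)) p∈n
    Avoid : Move → PSet I
    Avoid e x = ∀ p → p ∈ proj₂ e → ¬ P (piece p) x
    strategy : StrategyI D
    strategy = reacting-strategy filter Avoid
      (λ e → FilterProperties.⋂-∈ filter (λ p x → ¬ P (piece p) x) (∁P∈D ∘ piece) (proj₂ e))
    winning : ¬ (Σ (PSet I) λ A → D A × (∀ n → Finite (λ z → A z × P n z))) → WinningI D strategy
    winning ¬pPoint m legal U∈D = ¬pPoint (UnionOfPlay m , U∈D , finite)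
      where
        same-move : ∀ {n j k p z} → p ∈ proj₂ (m j) → P n p → z ∈ proj₂ (m k) → P n z → j ≡ k
        same-move {n} {j} {k} {p} {z} p∈ p∈n z∈ z∈n with <-cmp j k
        ... | tri≈ _ j≡k _ = j≡k
        ... | tri< j<k _ _ = ⊥-elim (later-reacts legal j<k z∈ p p∈ (subst (λ i → P i z) (sym (piece-unique p∈n)) z∈n))
        ... | tri> _ _ k<j = ⊥-elim (later-reacts legal k<j p∈ z z∈ (subst (λ i → P i p) (sym (piece-unique z∈n)) p∈n))
        finite : ∀ n → Finite (λ z → UnionOfPlay m z × P n z)
        finite n with lower-em em {Σ ℕ λ k → Σ I λ p → p ∈ proj₂ (m k) × P n p}
        ... | no none = [] , λ z ((k , z∈) , z∈n) → contradiction (k , z , z∈ , z∈n) none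
        ... | yes (k , p , p∈ , p∈n) =
          proj₂ (m k) , λ z ((j , z∈) , z∈n) → subst (λ i → z ∈ proj₂ (m i)) (same-move z∈ z∈n p∈ p∈n) z∈

star-nonPrincipal : {D : Family I} → IsUltrafilter D → NonPrincipal D → NonPrincipal (Star D)
star-nonPrincipal uf np = Block∉ uf np

semiRamsey⇒star-ramsey : ExcludedMiddle (Level.suc 0ℓ) → {D : Family I} → IsUltrafilter D →
                         SemiRamsey D → Ramsey (Star D)
semiRamsey⇒star-ramsey em {D} uf semiRamsey F F-sym =
  em⇒dne em λ ¬homogeneous → semiRamsey (strategy , winning ¬homogeneous)
  where
    open IsFilter (IsUltrafilter.isFilter uf)
    open UltrafilterProperties (Pushforward-isUltrafilter proj₁ uf)
    c : ℕ → Bool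
    c n = proj₁ (bool-colour (F n))
    Follow : Move → PSet I
    Follow e x = F (proj₁ e) (proj₁ x) ≡ c (proj₁ e)
    strategy : StrategyI D
    strategy = reacting-strategy (IsUltrafilter.isFilter uf) Follow (λ e → proj₂ (bool-colour (F (proj₁ e))))
    winning : ¬ (Σ (PSet ℕ) λ H → Star D H × Σ Bool λ b → ∀ x y → H x → H y → x ≢ y → F x y ≡ b) →
              WinningI D strategy
    winning ¬homogeneous m legal U∈D = ¬homogeneous (H , H∈D* , b , homogeneous)
      where
        Played : PSet ℕ
        Played n = Σ ℕ λ k → proj₁ (m k) ≡ n × Σ I λ p → p ∈ proj₂ (m k)
        Played∈D* : Star D Played
        Played∈D* = upward (UnionOfPlay m) _ (λ x (k , x∈) → k , sym (proj₂ (proj₂ (legal k) x x∈)) , x , x∈) U∈D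
        earlier : ∀ {j k p} → j < k → p ∈ proj₂ (m k) → F (proj₁ (m j)) (proj₁ (m k)) ≡ c (proj₁ (m j))
        earlier {k = k} j<k p∈ = subst (λ i → F _ i ≡ _) (proj₂ (proj₂ (legal k) _ p∈)) (later-reacts legal j<k p∈)
        b : Bool
        b = proj₁ (bool-colour c)
        H : PSet ℕ
        H n = Played n × c n ≡ b
        H∈D* : Star D H
        H∈D* = inter _ _ Played∈D* (proj₂ (bool-colour c))
        homogeneous : ∀ x y → H x → H y → x ≢ y → F x y ≡ b
        homogeneous _ _ ((j , refl , p , p∈) , cx≡b) ((k , refl , q , q∈) , cy≡b) x≢y with <-cmp j k
        ... | tri< j<k _ _ = trans (earlier j<k q∈) cx≡b
        ... | tri≈ _ refl _ = contradiction refl x≢y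
        ... | tri> _ _ k<j = trans (F-sym _ _) (trans (earlier k<j p∈) cy≡b)

singleMove : I → Move
singleMove x = proj₁ x , x ∷ []

shortMoves : ℕ → List Move
shortMoves K = (0 , []) ∷ map singleMove (pointsUpTo K)

-- A play enumerating one point per block, in increasing blocks, reaches its move k + 1 in
-- block K ≥ k after a history of k + 2 ≤ K + 2 moves from shortMoves K.
Answer : (List Move → PSet I) → ℕ → PSet I
Answer σ K y = ∀ h → h ∈ lists≤ (shortMoves K) (2 + K) → σ h y

Linked : (List Move → PSet I) → I → I → Set
Linked σ x y = (proj₁ x < proj₁ y → Answer σ (proj₁ x) y) × (proj₁ y < proj₁ x → Answer σ (proj₁ y) x)

blocks-differ : ∀ {x y : I} → proj₁ x < proj₁ y → x ≢ y
blocks-differ x<y refl = <-irrefl refl x<y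

module _ (em : ExcludedMiddle 0ℓ) {D : Family I} (uf : IsUltrafilter D) (np : NonPrincipal D) where
  open IsUltrafilter uf
  open IsFilter isFilter
  open UltrafilterProperties uf

  cover-by-play : (σ : List Move → PSet I) (H : PSet I) → D H → InjectiveOn proj₁ H →
                  (∀ x → H x → σ ((0 , []) ∷ []) x) →
                  (∀ x y → H x → H y → proj₁ x < proj₁ y → Answer σ (proj₁ x) y) →
                  Σ (ℕ → Move) λ m → LegalAgainst σ m × H ⊆' UnionOfPlay m
  cover-by-play σ H H∈D injective opening answers = play , legal , covered
    where
      open Enumeration (enumerate em (∈⇒unbounded uf np em H∈D))
      point : ℕ → I
      point k = at k , proj₁ (member k)
      point∈H : ∀ k → H (point k)
      point∈H k = proj₂ (member k)
      play : ℕ → Move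
      play zero    = 0 , []
      play (suc k) = singleMove (point k)
      history-short : ∀ k → history play (2 + k) ∈ lists≤ (shortMoves (at k)) (2 + at k)
      history-short k = ∈-lists≤ _ _ length≤ ⊆shortMoves
        where
          length≤ : length (history play (2 + k)) ≤ 2 + at k
          length≤ = subst (_≤ 2 + at k) (sym (trans (length-map play (upTo (2 + k))) (length-upTo (2 + k))))
                          (s≤s (s≤s (increasing⇒≥id increasing k)))
          ⊆shortMoves : ∀ e → e ∈ history play (2 + k) → e ∈ shortMoves (at k)
          ⊆shortMoves e e∈ with ∈-map⁻ play {xs = upTo (2 + k)} e∈
          ... | zero  , _  , refl = here refl
          ... | suc j , j∈ , refl = there (∈-map⁺ singleMove (∈-pointsUpTo (point j)
                                      (increasing⇒monotone increasing (≤-pred (≤-pred (∈-upTo⁻ j∈))))))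
      answered : ∀ k → σ (history play (suc k)) (point k)
      answered zero    = opening _ (point∈H 0)
      answered (suc k) = answers (point k) (point (suc k)) (point∈H k) (point∈H (suc k)) (increasing k) _ (history-short k)
      legal : LegalAgainst σ play
      legal zero    = z≤n , λ _ ()
      legal (suc k) = s≤s z≤n , λ { x (here refl) → answered k , refl }
      covered : H ⊆' UnionOfPlay play
      covered x x∈H with onto (proj₁ x) (proj₂ x , x∈H)
      ... | k , at≡ = suc k , here (injective x (point k) x∈H (point∈H k) (sym at≡))

  selector : Ramsey D → Σ (PSet I) λ S → D S × InjectiveOn proj₁ S
  selector ram = ramsey⇒injectiveOn em ram proj₁ (Block∉ uf np)

  ramsey⇒semiRamsey : Ramsey D → SemiRamsey D
  ramsey⇒semiRamsey ram ((σ , σ∈D) , winning)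
    with ram (λ x y → does (em {Linked σ x y})) (λ x y → does-⇔ (mk⇔ swap swap) em em)
  ... | H , H∈D , false , hom = bounded∉ uf np (proj₁ x) _ answers-bounded (inter _ _ H∈D (answers∈D (proj₁ x)))
    where
      answers∈D : ∀ K → D (Answer σ K)
      answers∈D K = ⋂-∈ σ σ∈D (lists≤ (shortMoves K) (2 + K))
      x = proj₁ (∈⇒nonempty em H∈D)
      x∈H = proj₂ (∈⇒nonempty em H∈D)
      answers-bounded : ∀ y → H y × Answer σ (proj₁ x) y → proj₁ y ≤ proj₁ x
      answers-bounded y (y∈H , y-answers) with proj₁ y ≤? proj₁ x
      ... | yes y≤x = y≤x
      ... | no y≰x  = case trans (sym (dec-true em linked)) (hom x y x∈H y∈H (blocks-differ x<y)) of λ ()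
        where
          x<y = ≰⇒> y≰x
          linked : Linked σ x y
          linked = (λ _ → y-answers) , (λ y<x → contradiction x<y (<-asym y<x))
  ... | H , H∈D , true , hom = winning play legal (upward _ _ H′⊆play H′∈D)
    where
      S = proj₁ (selector ram)
      H′ : PSet I
      H′ x = H x × S x × σ ((0 , []) ∷ []) x
      H′∈D : D H′
      H′∈D = inter _ _ H∈D (inter _ _ (proj₁ (proj₂ (selector ram))) (σ∈D _))
      later-answers : ∀ x y → H′ x → H′ y → proj₁ x < proj₁ y → Answer σ (proj₁ x) y
      later-answers x y x∈H′ y∈H′ x<y =
        proj₁ (does⇒ em (hom x y (proj₁ x∈H′) (proj₁ y∈H′) (blocks-differ x<y))) x<y
      covering = cover-by-play σ H′ H′∈D
        (λ x y x∈H′ y∈H′ → proj₂ (proj₂ (selector ram)) x y (proj₁ (proj₂ x∈H′)) (proj₁ (proj₂ y∈H′)))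
        (λ x x∈H′ → proj₂ (proj₂ x∈H′)) later-answers
      play = proj₁ covering
      legal = proj₁ (proj₂ covering)
      H′⊆play = proj₂ (proj₂ covering)

  -- The selector meets every block in at most one point, so each [S ∩ block]^k has at most one member.
  ramsey⇒almostRamsey : Ramsey D → AlmostRamsey D
  ramsey⇒almostRamsey ram =
    ramsey⇒semiRamsey ram ,
    λ n L f → S , S∈D , λ i k _ s t |s|≡k |t|≡k s⊆S t⊆S →
      cong (f i) (equal-size⇒equal i s t s⊆S t⊆S (trans |s|≡k (sym |t|≡k)))
    where
      S = proj₁ (selector ram)
      S∈D = proj₁ (proj₂ (selector ram))
      fibre-injective : ∀ {i} {j j′ : Fin (suc i)} → _≡_ {A = I} (i , j) (i , j′) → j ≡ j′
      fibre-injective refl = refl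
      equal-size⇒equal : ∀ i (s t : Subset (suc i)) → (∀ j → j FS.∈ s → S (i , j)) → (∀ j → j FS.∈ t → S (i , j)) →
                         ∣ s ∣ ≡ ∣ t ∣ → s ≡ t
      equal-size⇒equal i = subsets-of-subsingleton (λ j → S (i , j))
        (λ j j′ j∈S j′∈S → fibre-injective (proj₂ (proj₂ (selector ram)) _ _ j∈S j′∈S refl))

proposition6p2p6 : ExcludedMiddle (Level.suc 0ℓ) →
    (D : Family I) → IsUltrafilter D → NonPrincipal D →
    ((Interesting D → ¬ QPoint D) ×
     (Ramsey D → AlmostRamsey D) ×
     (SemiRamsey D → PPoint D) ×
     (SemiRamsey D → IsUltrafilter (Star D) × NonPrincipal (Star D) × Ramsey (Star D)))
proposition6p2p6 em D uf np =
    interesting⇒¬qPoint (lower-em em) isFilter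
  , ramsey⇒almostRamsey (lower-em em) uf np
  , semiRamsey⇒pPoint em isFilter
  , λ semiRamsey → Pushforward-isUltrafilter proj₁ uf , star-nonPrincipal uf np , semiRamsey⇒star-ramsey em uf semiRamsey
  where open IsUltrafilter uf
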